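{- Let $n$ be a sufficiently large positive integer and $m$ an integer with $n^{6}\le m\le n^{C}$ for a fixed constant $C$. Let $x_1,\dots,x_n$ be independent uniformly random elements of $\mathbb{Z}_m=\{0,\dots,m-1\}$. The expected maxload of $\mathsf{SH}_m$ on $x_1,\dots,x_n$ (expectation over both the $x_i$ and the hash function) is $\mathcal{O}\!\left(\frac{\log n}{\log\log n}\right)$.
   Context: $\mathfrak{m}_m(x)$ is the unique element of $(x+m\mathbb{Z})\cap[0,m)$; $\mathbb{Z}_m^{\times}$ is the set of $k\in\{0,\dots,m-1\}$ coprime to $m$. Smart linear hashing $\mathsf{SH}_m$ into $n$ bins: choose $a$ uniformly from $\mathbb{Z}_m^{\times}$ (independently of the $x_i$) and place $x$ in bin $\lfloor\mathfrak{m}_m(ax)/(m/n)\rfloor$. The maxload is the number of the items $x_1,\dots,x_n$ (counted with multiplicity) placed in the fullest bin. -}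

module Defs where

open import Data.Nat using (ℕ; zero; suc; _+_; _*_; _^_; _≤_; _⊔_)
open import Data.Nat.DivMod using (_%_; _/_)
open import Data.Nat.Coprimality using (coprime?)
open import Data.Nat.Properties using (_≟_)
open import Data.List using (List; []; _∷_; map; filter; upTo; concatMap; length)
open import Data.Nat.ListAction using (sum)
open import Data.Vec using (Vec; []; _∷_)
open import Relation.Nullary.Decidable using (does)
open import Data.Bool using (if_then_else_)

-- 𝔪_m(x) : the representative of x mod m in [0,m)   (m = 0 never used: m ≥ n^6 ≥ 1)
modm : ℕ → ℕ → ℕ
modm zero    x = x
modm (suc k) x = x % suc k

units : ℕ → List ℕ
units m = filter (λ k → coprime? k m) (upTo m)

-- bin of x under multiplier a: ⌊ 𝔪_m(a x) / (m/n) ⌋ = ⌊ n · 𝔪_m(a x) / m ⌋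
bin : ℕ → ℕ → ℕ → ℕ → ℕ
bin zero    n a x = zero
bin (suc k) n a x = (n * modm (suc k) (a * x)) / suc k

load : ℕ → ℕ → ℕ → {k : ℕ} → Vec ℕ k → ℕ → ℕ
load m n a []       b = 0
load m n a (x ∷ xs) b = (if does (bin m n a x ≟ b) then 1 else 0) + load m n a xs b

maxload : ℕ → ℕ → ℕ → {k : ℕ} → Vec ℕ k → ℕ
maxload m n a xs = Data.List.foldr _⊔_ 0 (map (load m n a xs) (upTo n))

allVecs : ℕ → (k : ℕ) → List (Vec ℕ k)
allVecs m zero    = [] ∷ []
allVecs m (suc k) = concatMap (λ x → map (x ∷_) (allVecs m k)) (upTo m)

-- Σ over a ∈ ℤ_m^× and (x_1,…,x_n) ∈ ℤ_m^n of maxload;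
-- the expected maxload is  totalMaxload m n / (|ℤ_m^×| · m^n)
totalMaxload : ℕ → ℕ → ℕ
totalMaxload m n = sum (concatMap (λ a → map (maxload m n a) (allVecs m n)) (units m))

-- For a multiplier a coprime to m, x ↦ a x mod m permutes ℤ_m, so each bin is the image of
-- c ≤ m/n + 1 ≤ 2m/n keys. Among k independent uniform keys, at least t land in a fixed bin
-- with probability at most (k c/m)^t / t! (a union bound over t-subsets), i.e. at most 2^t / t!
-- for k = n. The maxload never exceeds n, so it is at most t + n · #{bins with ≥ t keys}, and its
-- expectation is at most t + n² 2^t / t! ≤ t + 1 once n² 2^t ≤ t!. With L = ⌊log₂ n⌋ the
-- latter holds for some t ≈ 32 L / log₂ L, which gives the O(log n / log log n) bound.
module Submission where

open import Data.Bool using (if_then_else_)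
open import Data.List using (List; []; _∷_; map; upTo; concatMap; length; foldr; [_]; _++_)
open import Data.List.Properties using (map-∘; map-cong; map-++; map-concatMap; length-upTo; upTo-∷ʳ)
open import Data.List.Relation.Unary.All as All using (All; []; _∷_)
open import Data.List.Relation.Unary.All.Properties using (all-filter)
open import Data.Nat using (ℕ; zero; suc; _+_; _*_; _^_; _∸_; _⊔_; ∣_-_∣; _≤_; _<_; _!; ⌊_/2⌋; ⌈_/2⌉; z≤n; s≤s; s≤s⁻¹; NonZero; >-nonZero)
open import Data.Nat.Coprimality using (Coprime; coprime?; coprime-divisor) renaming (sym to coprime-sym)
open import Data.Nat.Divisibility using (_∣_; divides; n∣m⇒m%n≡0)
open import Data.Nat.DivMod using (_/_; _%_; m≡m%n+[m/n]*n; m/n*n≤m; m%n<n; m<n⇒m%n≡m)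
open import Data.Nat.Induction using (<-rec)
open import Data.Nat.ListAction using (sum)
open import Data.Nat.ListAction.Properties using (sum-++)
open import Data.Nat.Logarithm using (⌊log₂_⌋; ⌊log₂⌋-mono-≤; ⌊log₂[2^n]⌋≡n; ⌊log₂⌊n/2⌋⌋≡⌊log₂n⌋∸1)
open import Data.Nat.Properties
open import Data.Nat.Tactic.RingSolver using (solve-∀)
open import Algebra.Properties.CommutativeSemigroup *-commutativeSemigroup using (xy∙z≈xz∙y; xy∙z≈y∙xz; x∙yz≈y∙xz)
open import Data.Product using (∃-syntax; _×_; _,_; proj₂)
open import Data.Sum using (inj₁; inj₂)
open import Data.Vec as Vec using (Vec; []; _∷_)
open import Function using (_∘_)
open import Relation.Binary.PropositionalEquality hiding ([_])
open import Relation.Nullary using (Dec; yes; no; ¬_; does)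
open import Relation.Nullary.Decidable using (dec-true; dec-false)

open import Defs

-- Indicators and finite sums

𝟙 : {P : Set} → Dec P → ℕ
𝟙 d = if does d then 1 else 0

𝟙-yes : {P : Set} (d : Dec P) → P → 𝟙 d ≡ 1
𝟙-yes d p rewrite dec-true d p = refl

𝟙-no : {P : Set} (d : Dec P) → ¬ P → 𝟙 d ≡ 0
𝟙-no d ¬p rewrite dec-false d ¬p = refl

𝟙-≤1 : {P : Set} (d : Dec P) → 𝟙 d ≤ 1
𝟙-≤1 (yes _) = s≤s z≤n
𝟙-≤1 (no _)  = z≤n

𝟙-≤?-suc : ∀ t i v → i ≤ 1 → 𝟙 (suc t ≤? i + v) ≤ i * 𝟙 (t ≤? v) + 𝟙 (suc t ≤? v)
𝟙-≤?-suc t zero          v _ = ≤-refl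
𝟙-≤?-suc t (suc zero)    v _ with t ≤? v
... | yes t≤v rewrite 𝟙-yes (suc t ≤? suc v) (s≤s t≤v) | 𝟙-yes (t ≤? v) t≤v = s≤s z≤n
... | no  t≰v rewrite 𝟙-no (suc t ≤? suc v) (t≰v ∘ s≤s⁻¹) = z≤n
𝟙-≤?-suc t (suc (suc _)) v (s≤s ())

𝟙-threshold : ∀ n t v → v ≤ n → v ≤ t + n * 𝟙 (t ≤? v)
𝟙-threshold n t v v≤n with t ≤? v
... | yes t≤v rewrite 𝟙-yes (t ≤? v) t≤v = ≤-trans v≤n (≤-trans (≤-reflexive (sym (*-identityʳ n))) (m≤n+m _ t))
... | no  t≰v = ≤-trans (<⇒≤ (≰⇒> t≰v)) (m≤m+n t _)

variable
  A B : Set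

∑ : List A → (A → ℕ) → ℕ
∑ xs f = sum (map f xs)

infix 8 ∑
syntax ∑ xs (λ x → e) = ∑[ x ∈ xs ] e

∑-cong : (xs : List A) {f g : A → ℕ} → (∀ x → f x ≡ g x) → ∑ xs f ≡ ∑ xs g
∑-cong xs f≗g = cong sum (map-cong f≗g xs)

∑-mono-≤ : (xs : List A) {f g : A → ℕ} → (∀ x → f x ≤ g x) → ∑ xs f ≤ ∑ xs g
∑-mono-≤ []       f≤g = z≤n
∑-mono-≤ (x ∷ xs) f≤g = +-mono-≤ (f≤g x) (∑-mono-≤ xs f≤g)

∑-distrib-+ : (xs : List A) (f g : A → ℕ) → ∑[ x ∈ xs ] (f x + g x) ≡ ∑ xs f + ∑ xs g
∑-distrib-+ []       f g = refl
∑-distrib-+ (x ∷ xs) f g rewrite ∑-distrib-+ xs f g = +-interchange (f x) (g x) (∑ xs f) (∑ xs g)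
  where
  +-interchange : ∀ a b c d → a + b + (c + d) ≡ a + c + (b + d)
  +-interchange = solve-∀

∑-*ʳ : (xs : List A) (f : A → ℕ) (c : ℕ) → ∑[ x ∈ xs ] (f x * c) ≡ ∑ xs f * c
∑-*ʳ []       f c = refl
∑-*ʳ (x ∷ xs) f c rewrite ∑-*ʳ xs f c = sym (*-distribʳ-+ c (f x) (∑ xs f))

∑-*ˡ : (xs : List A) (c : ℕ) (f : A → ℕ) → ∑[ x ∈ xs ] (c * f x) ≡ c * ∑ xs f
∑-*ˡ []       c f = sym (*-zeroʳ c)
∑-*ˡ (x ∷ xs) c f rewrite ∑-*ˡ xs c f = sym (*-distribˡ-+ c (f x) (∑ xs f))

∑-const : (xs : List A) (c : ℕ) → ∑[ _ ∈ xs ] c ≡ length xs * c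
∑-const []       c = refl
∑-const (x ∷ xs) c = cong (c +_) (∑-const xs c)

∑-≤-length* : (xs : List A) {f : A → ℕ} {c : ℕ} → All (λ x → f x ≤ c) xs → ∑ xs f ≤ length xs * c
∑-≤-length* []       []           = z≤n
∑-≤-length* (x ∷ xs) (fx≤c ∷ f≤c) = +-mono-≤ fx≤c (∑-≤-length* xs f≤c)

∑-comm : (xs : List A) (ys : List B) (f : A → B → ℕ) →
         ∑[ x ∈ xs ] ∑[ y ∈ ys ] f x y ≡ ∑[ y ∈ ys ] ∑[ x ∈ xs ] f x y
∑-comm []       ys f = sym (trans (∑-const ys 0) (*-zeroʳ (length ys)))
∑-comm (x ∷ xs) ys f = begin
  ∑ ys (f x) + ∑[ x ∈ xs ] ∑[ y ∈ ys ] f x y ≡⟨ cong (∑ ys (f x) +_) (∑-comm xs ys f) ⟩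
  ∑ ys (f x) + ∑[ y ∈ ys ] ∑[ x ∈ xs ] f x y ≡⟨ ∑-distrib-+ ys (f x) _ ⟨
  ∑[ y ∈ ys ] (f x y + ∑[ x ∈ xs ] f x y)    ∎
  where open ≡-Reasoning

sum-concatMap : (g : A → List ℕ) (xs : List A) → sum (concatMap g xs) ≡ ∑[ x ∈ xs ] sum (g x)
sum-concatMap g []       = refl
sum-concatMap g (x ∷ xs) = trans (sum-++ (g x) (concatMap g xs)) (cong (sum (g x) +_) (sum-concatMap g xs))

∑-concatMap : (g : A → List B) (f : B → ℕ) (xs : List A) → ∑ (concatMap g xs) f ≡ ∑[ x ∈ xs ] ∑ (g x) f
∑-concatMap g f xs = trans (cong sum (map-concatMap f g xs)) (sum-concatMap (map f ∘ g) xs)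

∑-upTo-suc : (M : ℕ) (f : ℕ → ℕ) → ∑ (upTo (suc M)) f ≡ ∑ (upTo M) f + f M
∑-upTo-suc M f = begin
  sum (map f (upTo (suc M)))      ≡⟨ cong (sum ∘ map f) (upTo-∷ʳ M) ⟨
  sum (map f (upTo M ++ [ M ]))   ≡⟨ cong sum (map-++ f (upTo M) [ M ]) ⟩
  sum (map f (upTo M) ++ [ f M ]) ≡⟨ sum-++ (map f (upTo M)) [ f M ] ⟩
  ∑ (upTo M) f + (f M + 0)        ≡⟨ cong (∑ (upTo M) f +_) (+-identityʳ (f M)) ⟩
  ∑ (upTo M) f + f M              ∎
  where open ≡-Reasoning

∑-upTo-const : (M c : ℕ) → ∑[ _ ∈ upTo M ] c ≡ M * c
∑-upTo-const M c = trans (∑-const (upTo M) c) (cong (_* c) (length-upTo M))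

term-≤-∑-upTo : (M : ℕ) (f : ℕ → ℕ) {y : ℕ} → y < M → f y ≤ ∑ (upTo M) f
term-≤-∑-upTo (suc M) f {y} y<1+M rewrite ∑-upTo-suc M f with m≤n⇒m<n∨m≡n (s≤s⁻¹ y<1+M)
... | inj₁ y<M  = ≤-trans (term-≤-∑-upTo M f y<M) (m≤m+n _ (f M))
... | inj₂ refl = m≤n+m (f y) _

∑-upTo-≡0 : (M : ℕ) (f : ℕ → ℕ) → (∀ {x} → x < M → f x ≡ 0) → ∑ (upTo M) f ≡ 0
∑-upTo-≡0 zero    f f≡0 = refl
∑-upTo-≡0 (suc M) f f≡0 rewrite ∑-upTo-suc M f =
  cong₂ _+_ (∑-upTo-≡0 M f (f≡0 ∘ m<n⇒m<1+n)) (f≡0 ≤-refl)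

InjectiveOn< : ℕ → (ℕ → ℕ) → Set
InjectiveOn< M h = ∀ {x x′} → x < M → x′ < M → h x ≡ h x′ → x ≡ x′

fibre-size-≤1 : (M : ℕ) (h : ℕ → ℕ) (y : ℕ) → InjectiveOn< M h → ∑[ x ∈ upTo M ] 𝟙 (y ≟ h x) ≤ 1
fibre-size-≤1 zero    h y inj = z≤n
fibre-size-≤1 (suc M) h y inj rewrite ∑-upTo-suc M (λ x → 𝟙 (y ≟ h x)) with y ≟ h M
... | no y≢hM rewrite 𝟙-no (y ≟ h M) y≢hM | +-identityʳ (∑[ x ∈ upTo M ] 𝟙 (y ≟ h x)) =
  fibre-size-≤1 M h y (λ p q → inj (m<n⇒m<1+n p) (m<n⇒m<1+n q))
... | yes y≡hM rewrite 𝟙-yes (y ≟ h M) y≡hM = ≤-reflexive (cong (_+ 1) (∑-upTo-≡0 M _ missed))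
  where
  missed : ∀ {x} → x < M → 𝟙 (y ≟ h x) ≡ 0
  missed x<M = 𝟙-no (y ≟ h _) λ y≡hx →
    <-irrefl (inj (m<n⇒m<1+n x<M) ≤-refl (trans (sym y≡hx) y≡hM)) x<M

∑-∘-injective-≤ : (M : ℕ) (h : ℕ → ℕ) (f : ℕ → ℕ) → (∀ x → h x < M) → InjectiveOn< M h →
                  ∑[ x ∈ upTo M ] f (h x) ≤ ∑ (upTo M) f
∑-∘-injective-≤ M h f h<M inj = begin
  ∑[ x ∈ upTo M ] f (h x)                              ≤⟨ ∑-mono-≤ (upTo M) spread ⟩
  ∑[ x ∈ upTo M ] ∑[ y ∈ upTo M ] (𝟙 (y ≟ h x) * f y) ≡⟨ ∑-comm (upTo M) (upTo M) _ ⟩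
  ∑[ y ∈ upTo M ] ∑[ x ∈ upTo M ] (𝟙 (y ≟ h x) * f y) ≡⟨ ∑-cong (upTo M) (λ y → ∑-*ʳ (upTo M) _ (f y)) ⟩
  ∑[ y ∈ upTo M ] (∑[ x ∈ upTo M ] 𝟙 (y ≟ h x) * f y) ≤⟨ ∑-mono-≤ (upTo M) (λ y → *-monoˡ-≤ (f y) (fibre-size-≤1 M h y inj)) ⟩
  ∑[ y ∈ upTo M ] (1 * f y)                            ≡⟨ ∑-cong (upTo M) (λ y → *-identityˡ (f y)) ⟩
  ∑ (upTo M) f                                         ∎
  where
  open ≤-Reasoning
  spread : ∀ x → f (h x) ≤ ∑[ y ∈ upTo M ] (𝟙 (y ≟ h x) * f y)
  spread x = begin
    f (h x)                                ≡⟨ *-identityˡ (f (h x)) ⟨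
    1 * f (h x)                            ≡⟨ cong (_* f (h x)) (𝟙-yes (h x ≟ h x) refl) ⟨
    𝟙 (h x ≟ h x) * f (h x)                ≤⟨ term-≤-∑-upTo M (λ y → 𝟙 (y ≟ h x) * f y) (h<M x) ⟩
    ∑[ y ∈ upTo M ] (𝟙 (y ≟ h x) * f y)   ∎

-- Powers, factorials and logarithms

^-distribʳ-* : ∀ x y t → (x * y) ^ t ≡ x ^ t * y ^ t
^-distribʳ-* x y zero    = refl
^-distribʳ-* x y (suc t) rewrite ^-distribʳ-* x y t = interchange x y (x ^ t) (y ^ t)
  where
  interchange : ∀ x y X Y → x * y * (X * Y) ≡ x * X * (y * Y)
  interchange = solve-∀

k^t*[k+1+t]≤[1+k]^[1+t] : ∀ k t → k ^ t * (k + suc t) ≤ suc k ^ suc t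
k^t*[k+1+t]≤[1+k]^[1+t] k zero    = ≤-reflexive (base k)
  where
  base : ∀ k → 1 * (k + 1) ≡ (1 + k) * 1
  base = solve-∀
k^t*[k+1+t]≤[1+k]^[1+t] k (suc t) = begin
  k * k ^ t * (k + suc (suc t))                     ≤⟨ m≤m+n _ (k ^ t * suc t) ⟩
  k * k ^ t * (k + suc (suc t)) + k ^ t * suc t     ≡⟨ factor k (k ^ t) t ⟩
  suc k * (k ^ t * (k + suc t))                     ≤⟨ *-monoʳ-≤ (suc k) (k^t*[k+1+t]≤[1+k]^[1+t] k t) ⟩
  suc k * suc k ^ suc t                             ∎
  where
  open ≤-Reasoning
  factor : ∀ k X t → k * X * (k + (2 + t)) + X * (1 + t) ≡ (1 + k) * (X * (k + (1 + t)))
  factor = solve-∀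

2*n≤2^n : ∀ n → 2 * n ≤ 2 ^ n
2*n≤2^n zero          = z≤n
2*n≤2^n (suc zero)    = ≤-refl
2*n≤2^n (suc (suc n)) = begin
  2 * suc (suc n)   ≡⟨ *-suc 2 (suc n) ⟩
  2 + 2 * suc n     ≤⟨ +-mono-≤ (*-monoʳ-≤ 2 (^-monoʳ-≤ 2 {0} {n} z≤n)) (2*n≤2^n (suc n)) ⟩
  2 * 2 ^ n + 2 ^ suc n  ≡⟨ cong (2 ^ suc n +_) (+-identityʳ (2 ^ suc n)) ⟨
  2 ^ suc (suc n)   ∎
  where open ≤-Reasoning

m^n≤[m+n]! : ∀ m n → m ^ n ≤ (m + n) !
m^n≤[m+n]! m zero    = 1≤n! (m + 0)
m^n≤[m+n]! m (suc n) = subst (λ k → m * m ^ n ≤ k !) (sym (+-suc m n))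
  (*-mono-≤ (≤-trans (m≤m+n m n) (n≤1+n (m + n))) (m^n≤[m+n]! m n))

n<2^[1+⌊log₂n⌋] : ∀ n → n < 2 ^ suc ⌊log₂ n ⌋
n<2^[1+⌊log₂n⌋] n = ≰⇒> λ 2^[1+L]≤n →
  1+n≰n (subst (_≤ ⌊log₂ n ⌋) (⌊log₂[2^n]⌋≡n (suc ⌊log₂ n ⌋)) (⌊log₂⌋-mono-≤ 2^[1+L]≤n))

2^⌊log₂n⌋≤n : ∀ n .{{_ : NonZero n}} → 2 ^ ⌊log₂ n ⌋ ≤ n
2^⌊log₂n⌋≤n n = <-rec (λ n → .{{_ : NonZero n}} → 2 ^ ⌊log₂ n ⌋ ≤ n) go n
  where
  go : ∀ n → (∀ {m} → m < n → .{{_ : NonZero m}} → 2 ^ ⌊log₂ m ⌋ ≤ m) →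
       .{{_ : NonZero n}} → 2 ^ ⌊log₂ n ⌋ ≤ n
  go 1               _   = ≤-refl
  go n@(suc (suc k)) rec = begin
    2 ^ ⌊log₂ n ⌋             ≡⟨ cong (2 ^_) (m+[n∸m]≡n 1≤⌊log₂n⌋) ⟨
    2 * 2 ^ (⌊log₂ n ⌋ ∸ 1)   ≡⟨ cong (λ e → 2 * 2 ^ e) (⌊log₂⌊n/2⌋⌋≡⌊log₂n⌋∸1 n) ⟨
    2 * 2 ^ ⌊log₂ ⌊ n /2⌋ ⌋   ≤⟨ *-monoʳ-≤ 2 (rec {⌊ n /2⌋} (⌊n/2⌋<n (suc k))) ⟩
    2 * ⌊ n /2⌋               ≤⟨ +-monoʳ-≤ ⌊ n /2⌋ (≤-trans (≤-reflexive (+-identityʳ _)) (⌊n/2⌋≤⌈n/2⌉ n)) ⟩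
    ⌊ n /2⌋ + ⌈ n /2⌉         ≡⟨ ⌊n/2⌋+⌈n/2⌉≡n n ⟩
    n                         ∎
    where
    open ≤-Reasoning
    1≤⌊log₂n⌋ : 1 ≤ ⌊log₂ n ⌋
    1≤⌊log₂n⌋ = ⌊log₂⌋-mono-≤ {2} {n} (s≤s (s≤s z≤n))

-- Bin sizes of multiplicative hashing

*-%-injective : ∀ m {a x x′} .{{_ : NonZero m}} → Coprime a m → x < m → x′ < m →
                (a * x) % m ≡ (a * x′) % m → x ≡ x′
*-%-injective m {a} {x} {x′} cop x<m x′<m ax≡ax′ = ∣m-n∣≡0⇒m≡n d≡0
  where
  q  = (a * x) / m
  q′ = (a * x′) / m
  r  = (a * x) % m
  open ≡-Reasoning
  a*d≡ : a * ∣ x - x′ ∣ ≡ ∣ q - q′ ∣ * m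
  a*d≡ = begin
    a * ∣ x - x′ ∣              ≡⟨ *-distribˡ-∣-∣ a x x′ ⟩
    ∣ a * x - a * x′ ∣          ≡⟨ cong₂ ∣_-_∣ (m≡m%n+[m/n]*n (a * x) m)
                                     (trans (m≡m%n+[m/n]*n (a * x′) m) (cong (_+ q′ * m) (sym ax≡ax′))) ⟩
    ∣ r + q * m - r + q′ * m ∣  ≡⟨ ∣m+n-m+o∣≡∣n-o∣ r (q * m) (q′ * m) ⟩
    ∣ q * m - q′ * m ∣          ≡⟨ *-distribʳ-∣-∣ m q q′ ⟨
    ∣ q - q′ ∣ * m              ∎
  m∣d : m ∣ ∣ x - x′ ∣
  m∣d = coprime-divisor (coprime-sym cop) (divides ∣ q - q′ ∣ a*d≡)
  d<m : ∣ x - x′ ∣ < m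
  d<m = ≤-<-trans (∣m-n∣≤m⊔n x x′) (⊔-pres-<m x<m x′<m)
  d≡0 : ∣ x - x′ ∣ ≡ 0
  d≡0 = trans (sym (m<n⇒m%n≡m d<m)) (n∣m⇒m%n≡0 ∣ x - x′ ∣ m m∣d)

floor-div-bounds : ∀ x m {b} .{{_ : NonZero m}} → x / m ≡ b → b * m ≤ x × x < m + b * m
floor-div-bounds x m refl =
  m/n*n≤m x m ,
  subst (_< m + (x / m) * m) (sym (m≡m%n+[m/n]*n x m)) (+-monoˡ-< ((x / m) * m) (m%n<n x m))

-- The first bound is the induction invariant: every counted y satisfies b m ≤ n y.
floor-fibre-bounds : ∀ m n b M .{{_ : NonZero m}} →
  n * ∑[ y ∈ upTo M ] 𝟙 ((n * y) / m ≟ b) ≤ n * M ∸ b * m ×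
  n * ∑[ y ∈ upTo M ] 𝟙 ((n * y) / m ≟ b) ≤ m + n
floor-fibre-bounds m n b zero rewrite *-zeroʳ n = z≤n , z≤n
floor-fibre-bounds m n b (suc M)
  rewrite ∑-upTo-suc M (λ y → 𝟙 ((n * y) / m ≟ b))
  with floor-fibre-bounds m n b M | (n * M) / m ≟ b
... | below , small | no ≢b
  rewrite 𝟙-no ((n * M) / m ≟ b) ≢b | +-identityʳ (∑[ y ∈ upTo M ] 𝟙 ((n * y) / m ≟ b)) =
  ≤-trans below (∸-monoˡ-≤ (b * m) (*-monoʳ-≤ n (n≤1+n M))) , small
... | below , _ | yes ≡b rewrite 𝟙-yes ((n * M) / m ≟ b) ≡b
  with floor-div-bounds (n * M) m ≡b
... | bm≤nM , nM<m+bm = ≤-trans step (≤-reflexive n*[1+M]∸bm) , ≤-trans step (+-monoˡ-≤ n gap≤m)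
  where
  c = ∑[ y ∈ upTo M ] 𝟙 ((n * y) / m ≟ b)
  step : n * (c + 1) ≤ (n * M ∸ b * m) + n
  step = subst (_≤ (n * M ∸ b * m) + n) (sym (trans (*-distribˡ-+ n c 1) (cong (n * c +_) (*-identityʳ n))))
           (+-monoˡ-≤ n below)
  n*[1+M]∸bm : (n * M ∸ b * m) + n ≡ n * suc M ∸ b * m
  n*[1+M]∸bm = trans (sym (+-∸-comm n bm≤nM)) (cong (_∸ b * m) (trans (+-comm (n * M) n) (sym (*-suc n M))))
  gap≤m : n * M ∸ b * m ≤ m
  gap≤m = ≤-trans (∸-monoˡ-≤ (b * m) (<⇒≤ nM<m+bm)) (≤-reflexive (m+n∸n≡m m (b * m)))

bin-fibre-bound : ∀ m n a b .{{_ : NonZero m}} → Coprime a m →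
                  n * ∑[ x ∈ upTo m ] 𝟙 (bin m n a x ≟ b) ≤ m + n
bin-fibre-bound m@(suc _) n a b cop = begin
  n * ∑[ x ∈ upTo m ] 𝟙 ((n * ((a * x) % m)) / m ≟ b)
    ≤⟨ *-monoʳ-≤ n (∑-∘-injective-≤ m (λ x → (a * x) % m) _ (λ x → m%n<n (a * x) m) (*-%-injective m cop)) ⟩
  n * ∑[ y ∈ upTo m ] 𝟙 ((n * y) / m ≟ b)             ≤⟨ proj₂ (floor-fibre-bounds m n b m) ⟩
  m + n                                                ∎
  where open ≤-Reasoning

-- Vectors with many hits

∑-allVecs-suc : ∀ m k (f : Vec ℕ (suc k) → ℕ) →
                ∑ (allVecs m (suc k)) f ≡ ∑[ x ∈ upTo m ] ∑[ xs ∈ allVecs m k ] f (x ∷ xs)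
∑-allVecs-suc m k f = trans (∑-concatMap _ f (upTo m))
  (∑-cong (upTo m) (λ x → cong sum (sym (map-∘ (allVecs m k)))))

∑-allVecs-const : ∀ m k c → ∑[ _ ∈ allVecs m k ] c ≡ m ^ k * c
∑-allVecs-const m zero    c = trans (+-identityʳ c) (sym (*-identityˡ c))
∑-allVecs-const m (suc k) c = begin
  ∑[ _ ∈ allVecs m (suc k) ] c                  ≡⟨ ∑-allVecs-suc m k (λ _ → c) ⟩
  ∑[ x ∈ upTo m ] ∑[ _ ∈ allVecs m k ] c        ≡⟨ ∑-cong (upTo m) (λ _ → ∑-allVecs-const m k c) ⟩
  ∑[ x ∈ upTo m ] (m ^ k * c)                   ≡⟨ ∑-upTo-const m (m ^ k * c) ⟩
  m * (m ^ k * c)                               ≡⟨ *-assoc m (m ^ k) c ⟨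
  m ^ suc k * c                                 ∎
  where open ≡-Reasoning

hits : (ℕ → ℕ) → ∀ {k} → Vec ℕ k → ℕ
hits p xs = Vec.sum (Vec.map p xs)

hits-≤-length : ∀ (p : ℕ → ℕ) {k} (xs : Vec ℕ k) → (∀ x → p x ≤ 1) → hits p xs ≤ k
hits-≤-length p []       p≤1 = z≤n
hits-≤-length p (x ∷ xs) p≤1 = +-mono-≤ (p≤1 x) (hits-≤-length p xs p≤1)

tailCount : (m : ℕ) (p : ℕ → ℕ) (k t : ℕ) → ℕ
tailCount m p k t = ∑[ xs ∈ allVecs m k ] 𝟙 (t ≤? hits p xs)

tailCount-suc : ∀ m p k t → (∀ x → p x ≤ 1) →
  tailCount m p (suc k) (suc t) ≤ ∑ (upTo m) p * tailCount m p k t + m * tailCount m p k (suc t)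
tailCount-suc m p k t p≤1 = begin
  tailCount m p (suc k) (suc t)
    ≡⟨ ∑-allVecs-suc m k (λ xs → 𝟙 (suc t ≤? hits p xs)) ⟩
  ∑[ x ∈ upTo m ] ∑[ xs ∈ allVecs m k ] 𝟙 (suc t ≤? p x + hits p xs)
    ≤⟨ ∑-mono-≤ (upTo m) (λ x → ∑-mono-≤ (allVecs m k) (λ xs → 𝟙-≤?-suc t (p x) (hits p xs) (p≤1 x))) ⟩
  ∑[ x ∈ upTo m ] ∑[ xs ∈ allVecs m k ] (p x * 𝟙 (t ≤? hits p xs) + 𝟙 (suc t ≤? hits p xs))
    ≡⟨ ∑-cong (upTo m) split ⟩
  ∑[ x ∈ upTo m ] (p x * tailCount m p k t + tailCount m p k (suc t))
    ≡⟨ ∑-distrib-+ (upTo m) _ _ ⟩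
  ∑[ x ∈ upTo m ] (p x * tailCount m p k t) + ∑[ x ∈ upTo m ] tailCount m p k (suc t)
    ≡⟨ cong₂ _+_ (∑-*ʳ (upTo m) p _) (∑-upTo-const m (tailCount m p k (suc t))) ⟩
  ∑ (upTo m) p * tailCount m p k t + m * tailCount m p k (suc t)
    ∎
  where
  open ≤-Reasoning
  split : ∀ x → ∑[ xs ∈ allVecs m k ] (p x * 𝟙 (t ≤? hits p xs) + 𝟙 (suc t ≤? hits p xs))
              ≡ p x * tailCount m p k t + tailCount m p k (suc t)
  split x = trans (∑-distrib-+ (allVecs m k) _ _) (cong (_+ _) (∑-*ˡ (allVecs m k) (p x) _))

-- #{xs with ≥ t hits} / m^k ≤ (k c / m)^t / t! for c = ∑ (upTo m) p, with denominators cleared.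
tailCount-bound : ∀ m p k t → (∀ x → p x ≤ 1) →
  tailCount m p k t * (t ! * m ^ t) ≤ k ^ t * ∑ (upTo m) p ^ t * m ^ k
tailCount-bound m p k zero p≤1 = ≤-reflexive (begin
  tailCount m p k 0 * 1 ≡⟨ *-identityʳ _ ⟩
  tailCount m p k 0     ≡⟨ ∑-cong (allVecs m k) (λ xs → 𝟙-yes (0 ≤? hits p xs) z≤n) ⟩
  ∑[ _ ∈ allVecs m k ] 1 ≡⟨ ∑-allVecs-const m k 1 ⟩
  m ^ k * 1             ≡⟨ *-identityʳ (m ^ k) ⟩
  m ^ k                 ≡⟨ +-identityʳ (m ^ k) ⟨
  1 * 1 * m ^ k         ∎)
  where open ≡-Reasoning
tailCount-bound m p zero (suc t) p≤1 rewrite 𝟙-no (suc t ≤? 0) λ () = z≤n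
tailCount-bound m p (suc k) (suc t) p≤1 = begin
  T (suc k) (suc t) * (suc t ! * m ^ suc t)
    ≤⟨ *-monoˡ-≤ _ (tailCount-suc m p k t p≤1) ⟩
  (c * T k t + m * T k (suc t)) * (suc t * t ! * (m * m ^ t))
    ≡⟨ regroup₁ c m (suc t) (T k t) (T k (suc t)) (t !) (m ^ t) ⟩
  c * m * suc t * (T k t * (t ! * m ^ t)) + m * (T k (suc t) * (suc t * t ! * (m * m ^ t)))
    ≤⟨ +-mono-≤ (*-monoʳ-≤ (c * m * suc t) (tailCount-bound m p k t p≤1))
                (*-monoʳ-≤ m (tailCount-bound m p k (suc t) p≤1)) ⟩
  c * m * suc t * (k ^ t * c ^ t * m ^ k) + m * (k * k ^ t * (c * c ^ t) * m ^ k)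
    ≡⟨ regroup₂ c m (suc t) k (k ^ t) (c ^ t) (m ^ k) ⟩
  k ^ t * (k + suc t) * (c * c ^ t * (m * m ^ k))
    ≤⟨ *-monoˡ-≤ _ (k^t*[k+1+t]≤[1+k]^[1+t] k t) ⟩
  suc k ^ suc t * (c * c ^ t * (m * m ^ k))
    ≡⟨ *-assoc (suc k ^ suc t) (c * c ^ t) (m * m ^ k) ⟨
  suc k ^ suc t * c ^ suc t * m ^ suc k
    ∎
  where
  open ≤-Reasoning
  T = tailCount m p
  c = ∑ (upTo m) p
  regroup₁ : ∀ c m s F₁ F₂ T P → (c * F₁ + m * F₂) * (s * T * (m * P))
                                 ≡ c * m * s * (F₁ * (T * P)) + m * (F₂ * (s * T * (m * P)))
  regroup₁ = solve-∀
  regroup₂ : ∀ c m s k X Y Z → c * m * s * (X * Y * Z) + m * (k * X * (c * Y) * Z)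
                               ≡ (X * (k + s)) * (c * Y * (m * Z))
  regroup₂ = solve-∀

-- Maxload

inBin : ℕ → ℕ → ℕ → ℕ → ℕ → ℕ
inBin m n a b x = 𝟙 (bin m n a x ≟ b)

load≡hits : ∀ m n a {k} (xs : Vec ℕ k) b → load m n a xs b ≡ hits (inBin m n a b) xs
load≡hits m n a []       b = refl
load≡hits m n a (x ∷ xs) b = cong (inBin m n a b x +_) (load≡hits m n a xs b)

tailCount-inBin-bound : ∀ m n a b t .{{_ : NonZero m}} → n ≤ m → Coprime a m →
  tailCount m (inBin m n a b) n t * t ! ≤ 2 ^ t * m ^ n
tailCount-inBin-bound m n a b t n≤m cop = *-cancelʳ-≤ _ _ (m ^ t) {{m^n≢0 m t}} (begin
  T * t ! * m ^ t        ≡⟨ *-assoc T (t !) (m ^ t) ⟩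
  T * (t ! * m ^ t)      ≤⟨ tailCount-bound m p n t (λ x → 𝟙-≤1 (bin m n a x ≟ b)) ⟩
  n ^ t * c ^ t * m ^ n  ≡⟨ cong (_* m ^ n) (^-distribʳ-* n c t) ⟨
  (n * c) ^ t * m ^ n    ≤⟨ *-monoˡ-≤ (m ^ n) (^-monoˡ-≤ t n*c≤2m) ⟩
  (2 * m) ^ t * m ^ n    ≡⟨ cong (_* m ^ n) (^-distribʳ-* 2 m t) ⟩
  2 ^ t * m ^ t * m ^ n  ≡⟨ xy∙z≈xz∙y (2 ^ t) (m ^ t) (m ^ n) ⟩
  2 ^ t * m ^ n * m ^ t  ∎)
  where
  open ≤-Reasoning
  p = inBin m n a b
  T = tailCount m p n t
  c = ∑ (upTo m) p
  n*c≤2m : n * c ≤ 2 * m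
  n*c≤2m = ≤-trans (bin-fibre-bound m n a b cop)
             (≤-trans (+-monoʳ-≤ m n≤m) (≤-reflexive (cong (m +_) (sym (+-identityʳ m)))))

foldr-⊔-≤-threshold : ∀ n t (g : ℕ → ℕ) (bs : List ℕ) → (∀ b → g b ≤ n) →
  foldr _⊔_ 0 (map g bs) ≤ t + n * ∑[ b ∈ bs ] 𝟙 (t ≤? g b)
foldr-⊔-≤-threshold n t g []       g≤n = z≤n
foldr-⊔-≤-threshold n t g (b ∷ bs) g≤n = ⊔-lub
  (≤-trans (𝟙-threshold n t (g b) (g≤n b)) (+-monoʳ-≤ t (*-monoʳ-≤ n (m≤m+n _ _))))
  (≤-trans (foldr-⊔-≤-threshold n t g bs g≤n) (+-monoʳ-≤ t (*-monoʳ-≤ n (m≤n+m _ _))))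

maxload-≤-threshold : ∀ m n a t (xs : Vec ℕ n) →
  maxload m n a xs ≤ t + n * ∑[ b ∈ upTo n ] 𝟙 (t ≤? hits (inBin m n a b) xs)
maxload-≤-threshold m n a t xs = subst (λ s → maxload m n a xs ≤ t + n * s)
  (∑-cong (upTo n) (λ b → cong (λ v → 𝟙 (t ≤? v)) (load≡hits m n a xs b)))
  (foldr-⊔-≤-threshold n t (load m n a xs) (upTo n) load≤n)
  where
  load≤n : ∀ b → load m n a xs b ≤ n
  load≤n b = subst (_≤ n) (sym (load≡hits m n a xs b))
    (hits-≤-length (inBin m n a b) xs (λ x → 𝟙-≤1 (bin m n a x ≟ b)))

∑-maxload-≤-tailCounts : ∀ m n a t →
  ∑ (allVecs m n) (maxload m n a) ≤ m ^ n * t + n * ∑[ b ∈ upTo n ] tailCount m (inBin m n a b) n t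
∑-maxload-≤-tailCounts m n a t = begin
  ∑ (allVecs m n) (maxload m n a)
    ≤⟨ ∑-mono-≤ (allVecs m n) (maxload-≤-threshold m n a t) ⟩
  ∑[ xs ∈ allVecs m n ] (t + n * ∑[ b ∈ upTo n ] E xs b)
    ≡⟨ ∑-distrib-+ (allVecs m n) _ _ ⟩
  ∑[ _ ∈ allVecs m n ] t + ∑[ xs ∈ allVecs m n ] (n * ∑[ b ∈ upTo n ] E xs b)
    ≡⟨ cong₂ _+_ (∑-allVecs-const m n t) (∑-*ˡ (allVecs m n) n _) ⟩
  m ^ n * t + n * ∑[ xs ∈ allVecs m n ] ∑[ b ∈ upTo n ] E xs b
    ≡⟨ cong (λ s → m ^ n * t + n * s) (∑-comm (allVecs m n) (upTo n) E) ⟩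
  m ^ n * t + n * ∑[ b ∈ upTo n ] tailCount m (inBin m n a b) n t
    ∎
  where
  open ≤-Reasoning
  E : Vec ℕ n → ℕ → ℕ
  E xs b = 𝟙 (t ≤? hits (inBin m n a b) xs)

∑-maxload-bound : ∀ m n a t .{{_ : NonZero m}} → n ≤ m → Coprime a m → n * n * 2 ^ t ≤ t ! →
  ∑ (allVecs m n) (maxload m n a) ≤ (t + 1) * m ^ n
∑-maxload-bound m n a t n≤m cop n²2ᵗ≤t! = *-cancelʳ-≤ _ _ (t !) {{t !≢0}} (begin
  ∑ (allVecs m n) (maxload m n a) * t !
    ≤⟨ *-monoˡ-≤ (t !) (∑-maxload-≤-tailCounts m n a t) ⟩
  (m ^ n * t + n * ∑[ b ∈ upTo n ] T b) * t !
    ≡⟨ trans (distribute (m ^ n * t) n (∑ (upTo n) T) (t !))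
         (cong (λ s → m ^ n * t * t ! + n * s) (sym (∑-*ʳ (upTo n) T (t !)))) ⟩
  m ^ n * t * t ! + n * ∑[ b ∈ upTo n ] (T b * t !)
    ≤⟨ +-monoʳ-≤ (m ^ n * t * t !) (*-monoʳ-≤ n (∑-≤-length* (upTo n)
         (All.universal (λ b → tailCount-inBin-bound m n a b t n≤m cop) (upTo n)))) ⟩
  m ^ n * t * t ! + n * (length (upTo n) * (2 ^ t * m ^ n))
    ≡⟨ cong (λ l → m ^ n * t * t ! + n * (l * (2 ^ t * m ^ n))) (length-upTo n) ⟩
  m ^ n * t * t ! + n * (n * (2 ^ t * m ^ n))
    ≡⟨ cong (m ^ n * t * t ! +_) (reassociate n (2 ^ t) (m ^ n)) ⟩
  m ^ n * t * t ! + n * n * 2 ^ t * m ^ n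
    ≤⟨ +-monoʳ-≤ (m ^ n * t * t !) (*-monoˡ-≤ (m ^ n) n²2ᵗ≤t!) ⟩
  m ^ n * t * t ! + t ! * m ^ n
    ≡⟨ collect (m ^ n) t (t !) ⟩
  (t + 1) * m ^ n * t !
    ∎)
  where
  open ≤-Reasoning
  T : ℕ → ℕ
  T b = tailCount m (inBin m n a b) n t
  distribute : ∀ x n s f → (x + n * s) * f ≡ x * f + n * (s * f)
  distribute = solve-∀
  reassociate : ∀ n P M → n * (n * (P * M)) ≡ n * n * P * M
  reassociate = solve-∀
  collect : ∀ M t f → M * t * f + f * M ≡ (t + 1) * M * f
  collect = solve-∀

totalMaxload-bound : ∀ m n t .{{_ : NonZero m}} → n ≤ m → n * n * 2 ^ t ≤ t ! →
  totalMaxload m n ≤ (t + 1) * (length (units m) * m ^ n)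
totalMaxload-bound m n t n≤m n²2ᵗ≤t! = begin
  totalMaxload m n
    ≡⟨ sum-concatMap (λ a → map (maxload m n a) (allVecs m n)) (units m) ⟩
  ∑[ a ∈ units m ] ∑ (allVecs m n) (maxload m n a)
    ≤⟨ ∑-≤-length* (units m) (All.map {P = λ a → Coprime a m} (λ {a} cop → ∑-maxload-bound m n a t n≤m cop n²2ᵗ≤t!)
                                       (all-filter (λ a → coprime? a m) (upTo m))) ⟩
  length (units m) * ((t + 1) * m ^ n)
    ≡⟨ x∙yz≈y∙xz (length (units m)) (t + 1) (m ^ n) ⟩
  (t + 1) * (length (units m) * m ^ n)
    ∎
  where open ≤-Reasoning

-- Choice of the threshold

threshold-factorial : ∀ L d g → L < 2 ^ suc (d + g) → 2 ^ g ≤ d + g → g ≤ d →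
  2 ^ (suc L + suc L + 2 ^ (5 + d)) ≤ (2 ^ (5 + d)) !
threshold-factorial L d g L<2^[1+l] 2^g≤l g≤d = begin
  2 ^ (suc L + suc L + 2 ^ (5 + d))  ≡⟨ cong (λ t → 2 ^ (suc L + suc L + t)) t≡s+s ⟩
  2 ^ (suc L + suc L + (s + s))      ≤⟨ ^-monoʳ-≤ 2 exponent-bound ⟩
  2 ^ ((4 + d) * s)                  ≡⟨ ^-*-assoc 2 (4 + d) s ⟨
  s ^ s                              ≤⟨ m^n≤[m+n]! s s ⟩
  (s + s) !                          ≡⟨ cong _! t≡s+s ⟨
  (2 ^ (5 + d)) !                    ∎
  where
  open ≤-Reasoning
  D = 2 ^ d
  s = 2 ^ (4 + d)
  t≡s+s : 2 ^ (5 + d) ≡ s + s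
  t≡s+s = cong (s +_) (+-identityʳ s)
  s≡16D : s ≡ 16 * D
  s≡16D = 2⁴*D≡16*D D
    where
    2⁴*D≡16*D : ∀ D → 2 * (2 * (2 * (2 * D))) ≡ 16 * D
    2⁴*D≡16*D = solve-∀
  1+L≤4dD : suc L ≤ 4 * d * D
  1+L≤4dD = begin
    suc L               ≤⟨ L<2^[1+l] ⟩
    2 * 2 ^ (d + g)     ≡⟨ cong (2 *_) (^-distribˡ-+-* 2 d g) ⟩
    2 * (D * 2 ^ g)     ≤⟨ *-monoʳ-≤ 2 (*-monoʳ-≤ D (≤-trans 2^g≤l (+-monoʳ-≤ d g≤d))) ⟩
    2 * (D * (d + d))   ≡⟨ regroup d D ⟩
    4 * d * D           ∎
    where
    regroup : ∀ d D → 2 * (D * (d + d)) ≡ 4 * d * D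
    regroup = solve-∀
  exponent-bound : suc L + suc L + (s + s) ≤ (4 + d) * s
  exponent-bound = begin
    suc L + suc L + (s + s)                                  ≤⟨ +-monoˡ-≤ (s + s) (+-mono-≤ 1+L≤4dD 1+L≤4dD) ⟩
    4 * d * D + 4 * d * D + (s + s)                          ≡⟨ cong (λ x → 4 * d * D + 4 * d * D + (x + x)) s≡16D ⟩
    4 * d * D + 4 * d * D + (16 * D + 16 * D)                ≤⟨ m≤m+n _ (32 * D + 8 * d * D) ⟩
    4 * d * D + 4 * d * D + (16 * D + 16 * D) + (32 * D + 8 * d * D)  ≡⟨ regroup d D ⟩
    (4 + d) * (16 * D)                                       ≡⟨ cong ((4 + d) *_) s≡16D ⟨
    (4 + d) * s                                              ∎
    where
    regroup : ∀ d D → 4 * d * D + 4 * d * D + (16 * D + 16 * D) + (32 * D + 8 * d * D) ≡ (4 + d) * (16 * D)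
    regroup = solve-∀

threshold-linear : ∀ L d g → 2 ^ (d + g) ≤ L → d + g < 2 ^ suc g →
  (2 ^ (5 + d) + 1) * (d + g) ≤ 65 * L
threshold-linear L d g 2^l≤L l<2^[1+g] = begin
  (t + 1) * (d + g)                  ≡⟨ distribute t (d + g) ⟩
  t * (d + g) + (d + g)              ≤⟨ +-mono-≤ (*-monoʳ-≤ t (<⇒≤ l<2^[1+g])) l≤L ⟩
  t * 2 ^ suc g + L                  ≡⟨ cong (_+ L) (collect-powers (2 ^ d) (2 ^ g)) ⟩
  64 * (2 ^ d * 2 ^ g) + L           ≡⟨ cong (λ x → 64 * x + L) (^-distribˡ-+-* 2 d g) ⟨
  64 * 2 ^ (d + g) + L               ≤⟨ +-monoˡ-≤ L (*-monoʳ-≤ 64 2^l≤L) ⟩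
  64 * L + L                         ≡⟨ collect L ⟩
  65 * L                             ∎
  where
  open ≤-Reasoning
  t = 2 ^ (5 + d)
  l≤L : d + g ≤ L
  l≤L = ≤-trans (m≤n*m (d + g) 2) (≤-trans (2*n≤2^n (d + g)) 2^l≤L)
  distribute : ∀ t l → (t + 1) * l ≡ t * l + l
  distribute = solve-∀
  collect-powers : ∀ D G → 2 * (2 * (2 * (2 * (2 * D)))) * (2 * G) ≡ 64 * (D * G)
  collect-powers = solve-∀
  collect : ∀ L → 64 * L + L ≡ 65 * L
  collect = solve-∀

-- t = 2^(5 + l - g) ≈ 32 L / l, where L = ⌊log₂ n⌋, l = ⌊log₂ L⌋ and g = ⌊log₂ l⌋.
threshold-exists : ∀ n → 4 ≤ n →
  ∃[ t ] (n * n * 2 ^ t ≤ t ! × (t + 1) * ⌊log₂ ⌊log₂ n ⌋ ⌋ ≤ 65 * ⌊log₂ n ⌋)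
threshold-exists n 4≤n = t , n²2ᵗ≤t! , subst (λ l → (t + 1) * l ≤ 65 * L) (sym l≡d+g)
  (threshold-linear L d g (subst (λ l → 2 ^ l ≤ L) l≡d+g 2^l≤L) (subst (_< 2 ^ suc g) l≡d+g (n<2^[1+⌊log₂n⌋] l)))
  where
  L = ⌊log₂ n ⌋
  l = ⌊log₂ L ⌋
  g = ⌊log₂ l ⌋
  d = l ∸ g
  t = 2 ^ (5 + d)
  2≤L : 2 ≤ L
  2≤L = subst (_≤ L) (⌊log₂[2^n]⌋≡n 2) (⌊log₂⌋-mono-≤ 4≤n)
  1≤l : 1 ≤ l
  1≤l = subst (_≤ l) (⌊log₂[2^n]⌋≡n 1) (⌊log₂⌋-mono-≤ 2≤L)
  2^l≤L : 2 ^ l ≤ L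
  2^l≤L = 2^⌊log₂n⌋≤n L {{>-nonZero (≤-trans (s≤s z≤n) 2≤L)}}
  2^g≤l : 2 ^ g ≤ l
  2^g≤l = 2^⌊log₂n⌋≤n l {{>-nonZero 1≤l}}
  2g≤l : 2 * g ≤ l
  2g≤l = ≤-trans (2*n≤2^n g) 2^g≤l
  l≡d+g : l ≡ d + g
  l≡d+g = sym (m∸n+n≡m (≤-trans (m≤n*m g 2) 2g≤l))
  g≤d : g ≤ d
  g≤d = +-cancelʳ-≤ g g d (subst (g + g ≤_) l≡d+g (subst (_≤ l) (cong (g +_) (+-identityʳ g)) 2g≤l))
  n≤2^[1+L] : n ≤ 2 ^ suc L
  n≤2^[1+L] = <⇒≤ (n<2^[1+⌊log₂n⌋] n)
  n²2ᵗ≤t! : n * n * 2 ^ t ≤ t !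
  n²2ᵗ≤t! = begin
    n * n * 2 ^ t                       ≤⟨ *-monoˡ-≤ (2 ^ t) (*-mono-≤ n≤2^[1+L] n≤2^[1+L]) ⟩
    2 ^ suc L * 2 ^ suc L * 2 ^ t       ≡⟨ cong (_* 2 ^ t) (^-distribˡ-+-* 2 (suc L) (suc L)) ⟨
    2 ^ (suc L + suc L) * 2 ^ t         ≡⟨ ^-distribˡ-+-* 2 (suc L + suc L) t ⟨
    2 ^ (suc L + suc L + t)             ≤⟨ threshold-factorial L d g (subst (λ l → L < 2 ^ suc l) l≡d+g (n<2^[1+⌊log₂n⌋] L))
                                             (subst (2 ^ g ≤_) l≡d+g 2^g≤l) g≤d ⟩
    t !                                 ∎
    where open ≤-Reasoning

mainTheorem12 : (C : ℕ) → ∃[ K ] ∃[ N ] ((n m : ℕ) → N ≤ n → n ^ 6 ≤ m → m ≤ n ^ C →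
    totalMaxload m n * ⌊log₂ ⌊log₂ n ⌋ ⌋ ≤ K * ⌊log₂ n ⌋ * (length (units m) * m ^ n))
mainTheorem12 C = 65 , 4 , bound
  where
  bound : (n m : ℕ) → 4 ≤ n → n ^ 6 ≤ m → m ≤ n ^ C →
    totalMaxload m n * ⌊log₂ ⌊log₂ n ⌋ ⌋ ≤ 65 * ⌊log₂ n ⌋ * (length (units m) * m ^ n)
  bound n m 4≤n n⁶≤m _ =   -- only n ≤ m is used
    let t , n²2ᵗ≤t! , [t+1]l≤65L = threshold-exists n 4≤n
    in  begin
      totalMaxload m n * l  ≤⟨ *-monoˡ-≤ l (totalMaxload-bound m n t {{m≢0}} n≤m n²2ᵗ≤t!) ⟩
      (t + 1) * V * l       ≡⟨ xy∙z≈y∙xz (t + 1) V l ⟩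
      V * ((t + 1) * l)     ≤⟨ *-monoʳ-≤ V [t+1]l≤65L ⟩
      V * (65 * L)          ≡⟨ *-comm V (65 * L) ⟩
      65 * L * V            ∎
    where
    open ≤-Reasoning
    L = ⌊log₂ n ⌋
    l = ⌊log₂ L ⌋
    V = length (units m) * m ^ n
    0<n : 0 < n
    0<n = ≤-trans (s≤s z≤n) 4≤n
    n≤m : n ≤ m
    n≤m = ≤-trans (m≤m*n n (n ^ 5) {{m^n≢0 n 5 {{>-nonZero 0<n}}}}) n⁶≤m
    m≢0 : NonZero m
    m≢0 = >-nonZero (≤-trans 0<n n≤m)
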